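{- Let $d, r, s \in \mathbb{N}$, let $\gamma > 0$ and let $X \subseteq \mathbb{R}^d$ be a finite set with $\operatorname{rank}(X) \ge r$. If $X_* \subseteq X$ with $\operatorname{rank}(X_*) < s$, then there exists a set $Z \subseteq X \setminus X_*$ such that $$|X_* + Z| \ge (r - s)|X_*|$$ and $|Z| \le r - s$.
   Context: For $S \subseteq \mathbb{R}^d$, $\operatorname{rank}(S)$ is the minimum dimension of an affine subspace of $\mathbb{R}^d$ containing $S$. $A + B = \{a + b : a \in A, b \in B\}$. -}

module Defs where

open import Level using (0ℓ)
open import Data.Nat as ℕ using (ℕ; zero; suc)
open import Data.Fin using (Fin; zero; suc)
open import Data.Vec using (Vec; zipWith; map; replicate)
open import Data.List using (List; length)
open import Data.List.Membership.Propositional using (_∈_; _∉_)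
open import Data.List.Relation.Unary.Unique.Propositional using (Unique)
open import Data.Product using (Σ; ∃; ∃-syntax; _×_; _,_)
open import Data.Sum using (_⊎_)
open import Relation.Binary.PropositionalEquality using (_≡_; _≢_)
open import Relation.Binary.Definitions using (Trichotomous; Transitive)
open import Algebra.Structures using (IsCommutativeRing)

-- The real numbers, given axiomatically as a complete ordered field
-- (any two such are isomorphic, so quantifying over all of them is the
-- same as speaking about ℝ).

record RealField : Set₁ where
  infixl 6 _+_
  infixl 7 _*_
  infix  4 _<_ _≤_
  field
    Carrier : Set
    _+_ _*_ : Carrier → Carrier → Carrier
    -_      : Carrier → Carrier
    _⁻¹     : Carrier → Carrier
    0# 1#   : Carrier
    _<_     : Carrier → Carrier → Set
    isCommutativeRing : IsCommutativeRing _≡_ _+_ _*_ -_ 0# 1#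
    0≢1        : 0# ≢ 1#
    inverse    : ∀ x → x ≢ 0# → x * (x ⁻¹) ≡ 1#
    <-trans    : Transitive _<_
    <-tri      : Trichotomous _≡_ _<_
    +-mono-<   : ∀ {x y} z → x < y → x + z < y + z
    *-pos      : ∀ {x y} → 0# < x → 0# < y → 0# < x * y

  _≤_ : Carrier → Carrier → Set
  x ≤ y = x < y ⊎ x ≡ y

  IsUpperBound : (Carrier → Set) → Carrier → Set
  IsUpperBound P b = ∀ x → P x → x ≤ b

  field
    complete : (P : Carrier → Set) → ∃ P → ∃ (IsUpperBound P) →
               ∃[ u ] (IsUpperBound P u × (∀ b → IsUpperBound P b → u ≤ b))

module Geometry (ℝ : RealField) where
  open RealField ℝ

  Point : ℕ → Set
  Point d = Vec Carrier d

  module _ {d : ℕ} where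
    _⊕_ : Point d → Point d → Point d
    _⊕_ = zipWith _+_

    _·_ : Carrier → Point d → Point d
    c · v = map (c *_) v

    𝟎 : Point d
    𝟎 = replicate d 0#

    lincomb : ∀ {k} → (Fin k → Carrier) → (Fin k → Point d) → Point d
    lincomb {zero}  c v = 𝟎
    lincomb {suc k} c v = (c zero · v zero) ⊕ lincomb (λ i → c (suc i)) (λ i → v (suc i))

    LinearlyIndependent : ∀ {k} → (Fin k → Point d) → Set
    LinearlyIndependent {k} v = ∀ c → lincomb c v ≡ 𝟎 → ∀ i → c i ≡ 0#

    -- the affine subspace p + span(v₁,…,v_k); with v linearly independent
    -- it has dimension k, and every affine subspace arises this way.
    InAffine : ∀ {k} → Point d → (Fin k → Point d) → Point d → Set
    InAffine p v x = ∃[ c ] x ≡ p ⊕ lincomb c v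

    LiesInAffineOfDim : List (Point d) → ℕ → Set
    LiesInAffineOfDim S k =
      ∃[ p ] ∃[ v ] (LinearlyIndependent {k} v × (∀ x → x ∈ S → InAffine p v x))

    RankGE : List (Point d) → ℕ → Set
    RankGE S r = ∀ k → LiesInAffineOfDim S k → r ℕ.≤ k

    RankLT : List (Point d) → ℕ → Set
    RankLT S s = ∃[ k ] (LiesInAffineOfDim S k × k ℕ.< s)

    -- finite sets are duplicate-free lists; |S| = length S
    FinSet : Set
    FinSet = Σ (List (Point d)) Unique

    InSumset : List (Point d) → List (Point d) → Point d → Set
    InSumset A B z = ∃[ a ] ∃[ b ] (a ∈ A × b ∈ B × z ≡ a ⊕ b)

    SumsetCardGE : List (Point d) → List (Point d) → ℕ → Set
    SumsetCardGE A B n =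
      ∃[ L ] (Unique L × (∀ z → z ∈ L → InSumset A B z) × n ℕ.≤ length L)

-- Grow Z greedily, adding any point x ∈ X whose translate X* + x misses X* + Z, so that
-- |X* + Z| = |Z| |X*| throughout.  The greedy step never gets stuck while |Z| < r − s:
-- each added point raises the dimension of an affine subspace containing X* ∪ Z by at
-- most one, so some such subspace A has dimension < s + |Z| < r ≤ rank X, hence some
-- x ∈ X lies outside A; and such an x is admissible, since a + x = b + z with a, b ∈ X*
-- and z ∈ Z would put x = b + z − a in A.  Choosing x is decidable (points have
-- decidable equality), but the rank bound is only available doubly negated, which
-- suffices to refute that no admissible point exists.
module Submission where

open import Defs
open import Level using (0ℓ)
open import Function using (_∘_)
open import Algebra.Bundles using (CommutativeRing; AbelianGroup)
import Algebra.Properties.AbelianGroup as AbelianGroupProperties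
import Algebra.Properties.CommutativeSemigroup as CommutativeSemigroupProperties
open import Data.Nat using (ℕ; zero; suc; _∸_; _≤_; _<_; s≤s)
open import Data.Nat.Properties
  using (≤-refl; ≤-reflexive; <-trans; <⇒≤; <⇒≱; n≮0; m<n⇒m<1+n; m∸n≢0⇒n<m
        ; m≤o∸n⇒m+n≤o)
open import Data.Fin using (Fin; zero; suc)
open import Data.Vec as Vec using ([]; _∷_; replicate)
open import Data.Vec.Properties
  using ( map-∘; map-cong; map-id; map-replicate; zipWith-assoc; zipWith-comm
        ; zipWith-identityˡ; zipWith-identityʳ; zipWith-inverseˡ; zipWith-inverseʳ)
import Data.Vec.Properties as Vec using (≡-dec)
import Data.Vec.Functional as Vector
open import Data.List as List using (List; []; _∷_; _++_; length)
open import Data.List.Properties using (length-++; length-map)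
open import Data.List.Membership.Propositional using (_∈_; _∉_; find; lose)
open import Data.List.Membership.Propositional.Properties
  using (∈-map⁻; ∈-++⁻; ∈-++⁺ˡ; ∈-++⁺ʳ)
open import Data.List.Relation.Unary.Any using (Any; here; there; any?)
import Data.List.Relation.Unary.All as All
open import Data.List.Relation.Unary.All.Properties using (¬Any⇒All¬)
open import Data.List.Relation.Unary.AllPairs using ([]; _∷_)
open import Data.List.Relation.Unary.Unique.Propositional using (Unique)
open import Data.List.Relation.Unary.Unique.Propositional.Properties using (map⁺; ++⁺)
open import Data.List.Relation.Binary.Disjoint.Propositional using (Disjoint)
open import Data.Product using (_×_; _,_; ∃-syntax)
open import Data.Sum using (inj₁; inj₂)
open import Data.Empty using (⊥-elim)
open import Relation.Nullary using (¬_; Dec; yes; no; contradiction)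
open import Relation.Nullary.Decidable using (_×-dec_; ¬?; ¬¬-excluded-middle)
open import Relation.Nullary.Negation using (¬¬-map; ¬¬-Monad)
open import Relation.Unary using (Decidable)
open import Relation.Binary.Definitions using (DecidableEquality; tri<; tri≈; tri>)
open import Relation.Binary.PropositionalEquality
open import Relation.Binary.PropositionalEquality.Algebra using (isMagma)

module AffineGeometry (ℝ : RealField) where
  open RealField ℝ hiding (_<_; _≤_)
  open Geometry ℝ

  private variable
    d k : ℕ

  commutativeRing : CommutativeRing 0ℓ 0ℓ
  commutativeRing = record { isCommutativeRing = isCommutativeRing }

  open CommutativeRing commutativeRing
    using ( +-assoc; +-comm; +-identityˡ; +-identityʳ; -‿inverseˡ; -‿inverseʳ
          ; *-assoc; *-comm; *-identityˡ; zeroˡ; zeroʳ; distribˡ; distribʳ; ring)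
  open import Algebra.Properties.Ring ring using (-1*x≈-x)

  _≟_ : DecidableEquality Carrier
  x ≟ y with <-tri x y
  ... | tri< _ x≢y _ = no x≢y
  ... | tri≈ _ x≡y _ = yes x≡y
  ... | tri> _ x≢y _ = no x≢y

  ⊕-abelianGroup : ℕ → AbelianGroup 0ℓ 0ℓ
  ⊕-abelianGroup d = record
    { Carrier = Point d
    ; _∙_ = _⊕_
    ; ε = 𝟎
    ; _⁻¹ = Vec.map -_
    ; isAbelianGroup = record
      { isGroup = record
        { isMonoid = record
          { isSemigroup = record { isMagma = isMagma _⊕_ ; assoc = zipWith-assoc +-assoc }
          ; identity = zipWith-identityˡ +-identityˡ , zipWith-identityʳ +-identityʳ
          }
        ; inverse = zipWith-inverseˡ -‿inverseˡ , zipWith-inverseʳ -‿inverseʳ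
        ; ⁻¹-cong = cong (Vec.map -_)
        }
      ; comm = zipWith-comm +-comm
      }
    }

  module ⊕-Group {d : ℕ} = AbelianGroup (⊕-abelianGroup d)
  module ⊕-Properties {d : ℕ} = AbelianGroupProperties (⊕-abelianGroup d)
  open ⊕-Group using (_-_) renaming (_⁻¹ to ⊝_)
  module ⊕-CommutativeSemigroupProperties {d : ℕ} =
    CommutativeSemigroupProperties (⊕-Group.commutativeSemigroup {d})
  open ⊕-CommutativeSemigroupProperties using (interchange)

  p⊕[x-p]≡x : ∀ (p x : Point d) → (p ⊕ (x - p)) ≡ x
  p⊕[x-p]≡x p x = trans (⊕-Group.comm p (x - p)) (⊕-Properties.//-rightDividesˡ p x)

  ·-distribˡ-⊕ : ∀ a (u w : Point d) → (a · (u ⊕ w)) ≡ ((a · u) ⊕ (a · w))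
  ·-distribˡ-⊕ a []      []      = refl
  ·-distribˡ-⊕ a (x ∷ u) (y ∷ w) = cong₂ _∷_ (distribˡ a x y) (·-distribˡ-⊕ a u w)

  ·-distribʳ-+ : ∀ a b (u : Point d) → ((a + b) · u) ≡ ((a · u) ⊕ (b · u))
  ·-distribʳ-+ a b []      = refl
  ·-distribʳ-+ a b (x ∷ u) = cong₂ _∷_ (distribʳ x a b) (·-distribʳ-+ a b u)

  ·-assoc : ∀ a b (u : Point d) → (a · (b · u)) ≡ ((a * b) · u)
  ·-assoc a b u = trans (sym (map-∘ (a *_) (b *_) u)) (map-cong (λ x → sym (*-assoc a b x)) u)

  ·-identityˡ : ∀ (u : Point d) → (1# · u) ≡ u
  ·-identityˡ u = trans (map-cong *-identityˡ u) (map-id u)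

  ·-zeroˡ : ∀ (u : Point d) → (0# · u) ≡ 𝟎
  ·-zeroˡ []      = refl
  ·-zeroˡ (x ∷ u) = cong₂ _∷_ (zeroˡ x) (·-zeroˡ u)

  ·-zeroʳ : ∀ a → (a · 𝟎 {d}) ≡ 𝟎
  ·-zeroʳ {d} a = trans (map-replicate (a *_) 0# d) (cong (replicate d) (zeroʳ a))

  -1·u≡⊝u : ∀ (u : Point d) → ((- 1#) · u) ≡ ⊝ u
  -1·u≡⊝u = map-cong -1*x≈-x

  ·-zeroˡ-⊕ : ∀ (w u : Point d) → ((0# · w) ⊕ u) ≡ u
  ·-zeroˡ-⊕ w u = trans (cong (_⊕ u) (·-zeroˡ w)) (⊕-Group.identityˡ u)

  ·-cancel : ∀ {c} {u w : Point d} → c ≢ 0# → (c · u) ≡ w → u ≡ ((c ⁻¹) · w)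
  ·-cancel {c = c} {u} {w} c≢0 c·u≡w = begin
    u                    ≡⟨ sym (·-identityˡ u) ⟩
    (1# · u)             ≡⟨ cong (_· u) (sym (trans (*-comm (c ⁻¹) c) (inverse c c≢0))) ⟩
    ((c ⁻¹ * c) · u)     ≡⟨ sym (·-assoc (c ⁻¹) c u) ⟩
    ((c ⁻¹) · (c · u))   ≡⟨ cong ((c ⁻¹) ·_) c·u≡w ⟩
    ((c ⁻¹) · w)         ∎
    where open ≡-Reasoning

  lincomb-+ : ∀ (c c' : Fin k → Carrier) (v : Fin k → Point d) →
              (lincomb c v ⊕ lincomb c' v) ≡ lincomb (λ i → c i + c' i) v
  lincomb-+ {zero}  c c' v = ⊕-Group.identityˡ 𝟎
  lincomb-+ {suc k} c c' v = trans (interchange _ _ _ _)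
    (cong₂ _⊕_ (sym (·-distribʳ-+ (c zero) (c' zero) (v zero)))
               (lincomb-+ (c ∘ suc) (c' ∘ suc) (v ∘ suc)))

  lincomb-· : ∀ a (c : Fin k → Carrier) (v : Fin k → Point d) →
              (a · lincomb c v) ≡ lincomb (λ i → a * c i) v
  lincomb-· {zero}  a c v = ·-zeroʳ a
  lincomb-· {suc k} a c v = trans (·-distribˡ-⊕ a _ _)
    (cong₂ _⊕_ (·-assoc a (c zero) (v zero)) (lincomb-· a (c ∘ suc) (v ∘ suc)))

  lincomb-⊝ : ∀ (c : Fin k → Carrier) (v : Fin k → Point d) →
              ⊝ lincomb c v ≡ lincomb (λ i → (- 1#) * c i) v
  lincomb-⊝ c v = trans (sym (-1·u≡⊝u (lincomb c v))) (lincomb-· (- 1#) c v)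

  lincomb-0 : ∀ (v : Fin k → Point d) → lincomb (λ _ → 0#) v ≡ 𝟎
  lincomb-0 {zero}  v = refl
  lincomb-0 {suc k} v =
    trans (cong ((0# · v zero) ⊕_) (lincomb-0 (v ∘ suc))) (·-zeroˡ-⊕ (v zero) 𝟎)

  module _ {p : Point d} {v : Fin k → Point d} where

    InAffine-∷ : ∀ {w y} → InAffine p v y → InAffine p (w Vector.∷ v) y
    InAffine-∷ {w} (c , y≡p⊕cv) =
      (0# Vector.∷ c) , trans y≡p⊕cv (cong (p ⊕_) (sym (·-zeroˡ-⊕ w _)))

    InAffine-direction : ∀ {x} → InAffine p ((x - p) Vector.∷ v) x
    InAffine-direction {x} = (1# Vector.∷ λ _ → 0#) , sym (begin
      (p ⊕ ((1# · (x - p)) ⊕ lincomb (λ _ → 0#) v))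
        ≡⟨ cong₂ (λ a b → p ⊕ (a ⊕ b)) (·-identityˡ (x - p)) (lincomb-0 v) ⟩
      (p ⊕ ((x - p) ⊕ 𝟎))  ≡⟨ cong (p ⊕_) (⊕-Group.identityʳ (x - p)) ⟩
      (p ⊕ (x - p))        ≡⟨ p⊕[x-p]≡x p x ⟩
      x                    ∎)
      where open ≡-Reasoning

    InAffine-cancelˡ : ∀ {a b z x} → InAffine p v a → InAffine p v b → InAffine p v z →
                       (a ⊕ x) ≡ (b ⊕ z) → InAffine p v x
    InAffine-cancelˡ {x = x} (ca , refl) (cb , refl) (cz , refl) a⊕x≡b⊕z =
      (λ i → (cb i + cz i) + (- 1#) * ca i) ,
      trans (⊕-Properties.∙-cancelˡ a x (p ⊕ m) (trans a⊕x≡b⊕z (sym a⊕[p⊕m]≡b⊕z)))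
            (cong (p ⊕_) m≡)
      where
      open ≡-Reasoning
      la = lincomb ca v
      lb = lincomb cb v
      lz = lincomb cz v
      a = p ⊕ la
      m = (lb ⊕ lz) - la
      la⊕m≡lb⊕lz : (la ⊕ m) ≡ (lb ⊕ lz)
      la⊕m≡lb⊕lz = trans (⊕-Group.comm la m) (⊕-Properties.//-rightDividesˡ la (lb ⊕ lz))
      a⊕[p⊕m]≡b⊕z : (a ⊕ (p ⊕ m)) ≡ ((p ⊕ lb) ⊕ (p ⊕ lz))
      a⊕[p⊕m]≡b⊕z = begin
        ((p ⊕ la) ⊕ (p ⊕ m))  ≡⟨ interchange p la p m ⟩
        ((p ⊕ p) ⊕ (la ⊕ m))  ≡⟨ cong ((p ⊕ p) ⊕_) la⊕m≡lb⊕lz ⟩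
        ((p ⊕ p) ⊕ (lb ⊕ lz)) ≡⟨ interchange p p lb lz ⟩
        ((p ⊕ lb) ⊕ (p ⊕ lz)) ∎
      m≡ : m ≡ lincomb (λ i → (cb i + cz i) + (- 1#) * ca i) v
      m≡ = trans (cong₂ _⊕_ (lincomb-+ cb cz v) (lincomb-⊝ ca v)) (lincomb-+ _ _ v)

    LinearlyIndependent-∷ : ∀ {x} → LinearlyIndependent v → ¬ InAffine p v x →
                            LinearlyIndependent ((x - p) Vector.∷ v)
    LinearlyIndependent-∷ {x} v-indep x∉A c c·v≡𝟎 with c zero ≟ 0#
    ... | yes c₀≡0 = λ { zero → c₀≡0 ; (suc i) → v-indep (c ∘ suc) tail≡𝟎 i }
      where
      tail≡𝟎 : lincomb (c ∘ suc) v ≡ 𝟎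
      tail≡𝟎 = begin
        lincomb (c ∘ suc) v                         ≡⟨ ·-zeroˡ-⊕ (x - p) _ ⟨
        ((0# · (x - p)) ⊕ lincomb (c ∘ suc) v)      ≡⟨ cong₂ _⊕_ (cong (_· (x - p)) c₀≡0) refl ⟨
        ((c zero · (x - p)) ⊕ lincomb (c ∘ suc) v)  ≡⟨ c·v≡𝟎 ⟩
        𝟎                                           ∎
        where open ≡-Reasoning
    ... | no c₀≢0 = ⊥-elim (x∉A (_ , trans (sym (p⊕[x-p]≡x p x)) (cong (p ⊕_) x-p≡)))
      where
      open ≡-Reasoning
      c₀⁻¹ = c zero ⁻¹
      x-p≡ : (x - p) ≡ lincomb (λ i → c₀⁻¹ * ((- 1#) * c (suc i))) v
      x-p≡ = begin
        (x - p)
          ≡⟨ ·-cancel c₀≢0 (⊕-Properties.inverseˡ-unique _ _ c·v≡𝟎) ⟩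
        (c₀⁻¹ · (⊝ lincomb (c ∘ suc) v))
          ≡⟨ cong (c₀⁻¹ ·_) (lincomb-⊝ (c ∘ suc) v) ⟩
        (c₀⁻¹ · lincomb (λ i → (- 1#) * c (suc i)) v)
          ≡⟨ lincomb-· c₀⁻¹ _ v ⟩
        lincomb (λ i → c₀⁻¹ * ((- 1#) * c (suc i))) v
          ∎

  RankLT-∷ : ∀ {S : List (Point d)} {t} x → RankLT S t → ¬ ¬ RankLT (x ∷ S) (suc t)
  RankLT-∷ x (m , (p , v , v-indep , S⊆A) , m<t) = ¬¬-map extend ¬¬-excluded-middle
    where
    extend : Dec (InAffine p v x) → RankLT (x ∷ _) (suc _)
    extend (yes x∈A) = m , (p , v , v-indep , x∷S⊆A) , m<n⇒m<1+n m<t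
      where
      x∷S⊆A : ∀ y → y ∈ x ∷ _ → InAffine p v y
      x∷S⊆A _ (here refl)  = x∈A
      x∷S⊆A y (there y∈S) = S⊆A y y∈S
    extend (no x∉A) =
      suc m , (p , (x - p) Vector.∷ v , LinearlyIndependent-∷ v-indep x∉A , x∷S⊆A′) , s≤s m<t
      where
      x∷S⊆A′ : ∀ y → y ∈ x ∷ _ → InAffine p ((x - p) Vector.∷ v) y
      x∷S⊆A′ _ (here refl)  = InAffine-direction
      x∷S⊆A′ y (there y∈S) = InAffine-∷ (S⊆A y y∈S)

  RankGE⇒¬¬∉InAffine : ∀ {X : List (Point d)} {r p} {v : Fin k → Point d} →
                       RankGE X r → k < r → LinearlyIndependent v →
                       ¬ (∀ x → x ∈ X → ¬ ¬ InAffine p v x)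
  RankGE⇒¬¬∉InAffine {k = k} {p = p} {v} rank-X k<r v-indep X⊆¬¬A =
    All.sequenceM _ ¬¬-Monad (All.tabulate (X⊆¬¬A _))
      (λ X⊆A → <⇒≱ k<r (rank-X k (p , v , v-indep , λ _ → All.lookup X⊆A)))

-- Imported only here: inside AffineGeometry, _+_ and _*_ are the field operations.
open import Data.Nat using (_+_; _*_)

m<o∸n⇒m+n<o : ∀ m {n o} → m < o ∸ n → m + n < o
m<o∸n⇒m+n<o m {n} m<o∸n = m≤o∸n⇒m+n≤o (suc m) (<⇒≤ n<o) m<o∸n
  where
  n<o = m∸n≢0⇒n<m (λ o∸n≡0 → n≮0 (subst (m <_) o∸n≡0 m<o∸n))

module Sumset (ℝ : RealField) {d : ℕ} (A : List (Geometry.Point ℝ d)) where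
  open Geometry ℝ
  open AffineGeometry ℝ

  _≟ᵖ_ : DecidableEquality (Point d)
  _≟ᵖ_ = Vec.≡-dec _≟_

  open import Data.List.Membership.DecPropositional _≟ᵖ_ using (_∈?_)
  open import Data.List.Relation.Binary.Disjoint.DecPropositional _≟ᵖ_ using (disjoint?)

  sums : List (Point d) → List (Point d)
  sums []      = []
  sums (z ∷ Z) = List.map (_⊕ z) A ++ sums Z

  ∈-sums⁻ : ∀ Z y → y ∈ sums Z → InSumset A Z y
  ∈-sums⁻ (z ∷ Z) y y∈ with ∈-++⁻ (List.map (_⊕ z) A) y∈
  ... | inj₁ y∈A+z = let a , a∈A , y≡a⊕z = ∈-map⁻ (_⊕ z) y∈A+z
                     in a , z , a∈A , here refl , y≡a⊕z
  ... | inj₂ y∈A+Z = let a , b , a∈A , b∈Z , y≡a⊕b = ∈-sums⁻ Z y y∈A+Z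
                     in a , b , a∈A , there b∈Z , y≡a⊕b

  length-sums : ∀ Z → length (sums Z) ≡ length Z * length A
  length-sums []      = refl
  length-sums (z ∷ Z) = trans (length-++ (List.map (_⊕ z) A))
                              (cong₂ _+_ (length-map (_⊕ z) A) (length-sums Z))

  Admissible : List (Point d) → Point d → Set
  Admissible Z x = x ∉ A × x ∉ Z × Disjoint (List.map (_⊕ x) A) (sums Z)

  admissible? : ∀ Z → Decidable (Admissible Z)
  admissible? Z x = ¬? (x ∈? A) ×-dec ¬? (x ∈? Z) ×-dec disjoint? _ _

  Unique-sums-∷ : ∀ {Z x} → Unique A → Unique (sums Z) → Admissible Z x →
                  Unique (sums (x ∷ Z))
  Unique-sums-∷ {x = x} unique-A unique-sums (_ , _ , disjoint) =
    ++⁺ (map⁺ (λ {a} {b} → ⊕-Properties.∙-cancelʳ x a b) unique-A) unique-sums disjoint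

  ∉InAffine⇒Admissible : ∀ {k Z x p} {v : Fin k → Point d} →
                         (∀ y → y ∈ Z ++ A → InAffine p v y) → ¬ InAffine p v x →
                         Admissible Z x
  ∉InAffine⇒Admissible {Z = Z} {x} Z++A⊆P x∉P =
    (λ x∈A → x∉P (Z++A⊆P x (∈-++⁺ʳ Z x∈A))) ,
    (λ x∈Z → x∉P (Z++A⊆P x (∈-++⁺ˡ x∈Z))) ,
    disjoint
    where
    disjoint : Disjoint (List.map (_⊕ x) A) (sums Z)
    disjoint {y} (y∈A+x , y∈A+Z) with ∈-map⁻ (_⊕ x) y∈A+x | ∈-sums⁻ Z y y∈A+Z
    ... | a , a∈A , y≡a⊕x | b , z , b∈A , z∈Z , y≡b⊕z =
      x∉P (InAffine-cancelˡ (Z++A⊆P a (∈-++⁺ʳ Z a∈A)) (Z++A⊆P b (∈-++⁺ʳ Z b∈A))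
                            (Z++A⊆P z (∈-++⁺ˡ z∈Z)) (trans (sym y≡a⊕x) y≡b⊕z))

module Greedy (ℝ : RealField) {d : ℕ} (X X* : List (Geometry.Point ℝ d)) (unique-X* : Unique X*)
              (r s : ℕ) (rank-X : Geometry.RankGE ℝ X r) (rank-X* : Geometry.RankLT ℝ X* s) where
  open Geometry ℝ
  open AffineGeometry ℝ using (RankLT-∷; RankGE⇒¬¬∉InAffine)
  open Sumset ℝ X* public

  record Candidate (j : ℕ) : Set where
    field
      Z           : List (Point d)
      length-Z    : length Z ≡ j
      unique-Z    : Unique Z
      Z⊆X∖X*      : ∀ z → z ∈ Z → z ∈ X × z ∉ X*
      unique-sums : Unique (sums Z)
      rank-Z++X*  : ¬ ¬ RankLT (Z ++ X*) (j + s)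

  empty : Candidate 0
  empty = record
    { Z = [] ; length-Z = refl ; unique-Z = [] ; Z⊆X∖X* = λ _ ()
    ; unique-sums = [] ; rank-Z++X* = λ ¬rank → ¬rank rank-X* }

  extend : ∀ {j x} (C : Candidate j) → x ∈ X → Admissible (Candidate.Z C) x → Candidate (suc j)
  extend {x = x} C x∈X x-adm@(x∉X* , x∉Z , _) = record
    { Z = x ∷ Z
    ; length-Z = cong suc length-Z
    ; unique-Z = ¬Any⇒All¬ Z x∉Z ∷ unique-Z
    ; Z⊆X∖X* = λ { _ (here refl) → x∈X , x∉X* ; z (there z∈Z) → Z⊆X∖X* z z∈Z }
    ; unique-sums = Unique-sums-∷ unique-X* unique-sums x-adm
    ; rank-Z++X* = λ ¬rank → rank-Z++X* (λ rank → RankLT-∷ x rank ¬rank)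
    }
    where open Candidate C

  admissible-exists : ∀ {j} → j + s < r → (C : Candidate j) →
                      ¬ ¬ Any (Admissible (Candidate.Z C)) X
  admissible-exists j+s<r C ∄x = rank-Z++X* λ { (m , (p , v , v-indep , Z++X*⊆A) , m<j+s) →
    RankGE⇒¬¬∉InAffine rank-X (<-trans m<j+s j+s<r) v-indep
      (λ x x∈X x∉A → ∄x (lose x∈X (∉InAffine⇒Admissible Z++X*⊆A x∉A))) }
    where open Candidate C

  grow : ∀ {j} → j + s < r → Candidate j → Candidate (suc j)
  grow j+s<r C with any? (admissible? (Candidate.Z C)) X
  ... | yes ∃x = let _ , x∈X , x-adm = find ∃x in extend C x∈X x-adm
  ... | no  ∄x = contradiction ∄x (admissible-exists j+s<r C)

  greedy : ∀ j → j ≤ r ∸ s → Candidate j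
  greedy zero    _     = empty
  greedy (suc j) j<r∸s = grow (m<o∸n⇒m+n<o j j<r∸s) (greedy j (<⇒≤ j<r∸s))

lemma3p3 : (ℝ : RealField) → let open Geometry ℝ in
    (d r s : ℕ) (γ : RealField.Carrier ℝ) → RealField._<_ ℝ (RealField.0# ℝ) γ →
    (X : List (Point d)) → Unique X → RankGE X r →
    (X* : List (Point d)) → Unique X* → (∀ x → x ∈ X* → x ∈ X) → RankLT X* s →
    ∃[ Z ] (Unique Z × (∀ z → z ∈ Z → z ∈ X × z ∉ X*)
    × SumsetCardGE X* Z ((r ∸ s) * length X*)
    × length Z ≤ r ∸ s)
lemma3p3 ℝ d r s _ _ X _ rank-X X* unique-X* _ rank-X* =
  Z , unique-Z , Z⊆X∖X* , (sums Z , unique-sums , ∈-sums⁻ Z , ≤-reflexive |X*+Z|≡) ,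
  ≤-reflexive length-Z
  where
  open Greedy ℝ X X* unique-X* r s rank-X rank-X*
  open Candidate (greedy (r ∸ s) ≤-refl)
  |X*+Z|≡ : (r ∸ s) * length X* ≡ length (sums Z)
  |X*+Z|≡ = trans (cong (_* length X*) (sym length-Z)) (sym (length-sums Z))
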